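{- Let $F$ be a finite field of characteristic 2, and let $k, r$ be integers with $2 \leq r \leq k-1$. If there is a subset $X \subseteq F$ with $|X| = 2k+r$ and $e_{2m+1}(X) = 0_F$ for every nonnegative integer $m$ with $2m+1 \leq r$, then $\chi(K^2(2k+r,k)) \leq |F|^r$.
   Context: For a finite subset $Z = \{z_1,\ldots,z_n\}$ of a field $F$ and integer $i\ge 0$, $e_i(Z) = \sum_{1 \le t_1 < \cdots < t_i \le n} z_{t_1}\cdots z_{t_i}$, with $e_0(Z)=1_F$ and $e_i(Z)=0_F$ if $i>|Z|$. The Kneser graph $K(n,k)$ has as vertices the $k$-element subsets of an $n$-element set, adjacent iff disjoint; $K^2(n,k)$ is its square (same vertices, two distinct vertices adjacent iff at distance at most 2 in $K(n,k)$); $\chi$ is the chromatic number. -}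

module Defs where

open import Level using (Level; _⊔_)
open import Algebra.Bundles using (CommutativeRing)
open import Data.Nat using (ℕ; zero; suc)
open import Data.Fin using (Fin)
import Data.Fin as Fin
open import Data.Fin.Subset using (Subset; _∈_; ∣_∣)
open import Data.Product using (Σ; ∃; _×_; _,_; proj₁)
open import Data.Sum using (_⊎_)
open import Data.Empty using (⊥)
open import Relation.Nullary using (¬_)
open import Relation.Binary.PropositionalEquality using (_≡_; _≢_)

module _ {c ℓ : Level} (R : CommutativeRing c ℓ) where
  open CommutativeRing R

  record IsField : Set (c ⊔ ℓ) where
    field
      nontrivial : ¬ (1# ≈ 0#)
      inverse    : ∀ x → ¬ (x ≈ 0#) → ∃ λ y → (x * y) ≈ 1#

  HasChar2 : Set ℓ
  HasChar2 = (1# + 1#) ≈ 0#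

  record HasCardinality (q : ℕ) : Set (c ⊔ ℓ) where
    field
      enum       : Fin q → Carrier
      enum-inj   : ∀ i j → enum i ≈ enum j → i ≡ j
      enum-surj  : ∀ x → ∃ λ i → enum i ≈ x

  esym : (n : ℕ) → (Fin n → Carrier) → ℕ → Carrier
  esym zero    z zero    = 1#
  esym zero    z (suc i) = 0#
  esym (suc n) z zero    = 1#
  esym (suc n) z (suc i) =
    esym n (λ t → z (Fin.suc t)) (suc i) + (z Fin.zero * esym n (λ t → z (Fin.suc t)) i)

  -- a family z : Fin n → Carrier of pairwise distinct elements (a subset of size n)
  DistinctFamily : (n : ℕ) → (Fin n → Carrier) → Set ℓ
  DistinctFamily n z = ∀ i j → z i ≈ z j → i ≡ j

-- Kneser graph K(n,k): vertices are k-subsets of Fin n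
KVertex : ℕ → ℕ → Set
KVertex n k = Σ (Subset n) (λ s → ∣ s ∣ ≡ k)

Disjoint : {n : ℕ} → Subset n → Subset n → Set
Disjoint p q = ∀ i → i ∈ p → i ∈ q → ⊥

KAdj : {n k : ℕ} → KVertex n k → KVertex n k → Set
KAdj u v = Disjoint (proj₁ u) (proj₁ v)

K²Adj : {n k : ℕ} → KVertex n k → KVertex n k → Set
K²Adj {n} {k} u v =
  (u ≢ v) × (KAdj u v ⊎ (∃ λ (w : KVertex n k) → KAdj u w × KAdj w v))

χK²≤ : ℕ → ℕ → ℕ → Set
χK²≤ n k m = ∃ λ (col : KVertex n k → Fin m) →
  ∀ u v → K²Adj u v → col u ≢ col v

-- Colour a k-set A by the coefficients e₁, …, e_r of P_A(t) = ∏_{i ∈ A} (1 + X_i t). Suppose two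
-- vertices A ≠ B at distance at most 2 get the same colour, i.e. P_A ≡ P_B mod t^(r+1).
-- If A and B are disjoint, let D be the r points outside A ∪ B. Then P_X = P_A P_B P_D ≡ P_A² P_D, and in
-- characteristic 2 the square P_A² is a polynomial in t², so the vanishing of the odd e_i(X) forces P_D to be
-- a polynomial in t² as well. Then P_D' = 0, which is impossible for a product of r ≥ 2 distinct linear
-- factors: at the root of a factor 1 + d t with d ≠ 0 the derivative is d times the product of the others.
-- If A and B have a common neighbour, then |A ∪ B| ≤ k + r, so A ∖ B and B ∖ A have the same size s ≤ r;
-- cancelling P_{A ∩ B} gives P_{A∖B} ≡ P_{B∖A} mod t^(r+1), hence equality, as both have degree s. But
-- A ∖ B and B ∖ A are disjoint and nonempty, and X is injective, so one of them contains an i with X_i ≠ 0,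
-- and the root of 1 + X_i t separates the two polynomials.

module Submission where

open import Level using (Level)
open import Algebra.Bundles using (CommutativeRing)
open import Data.Empty using (⊥-elim)
open import Data.Fin using (Fin; zero; suc; toℕ; fromℕ<; funToFin; finToFun)
open import Data.Fin.Properties using (0≢1+n; suc-injective; toℕ-fromℕ<; finToFun-funToFin)
open import Data.Fin.Subset
  using (Subset; inside; outside; _∪_; _∩_; _─_; _-_; ∁; ⊤; _∈_; _∉_; _⊆_; ∣_∣; Nonempty)
open import Data.Fin.Subset.Properties
  using (_∈?_; ⊆-antisym; ∣p∣≤n; ∣∁p∣≡n∸∣p∣; p∪∁p≡⊤; x∈p⇒x∉∁p; x∈p∪q⁻; p─q⊆p; p∩q⊆q; ∩-comm;
         x∈p∧x∉q⇒x∈p─q; x∈p⇒∣p-x∣<∣p∣)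
open import Data.List using (List; []; _∷_; length)
import Data.List.Membership.Propositional as List
open import Data.List.Relation.Unary.All using (All; []; _∷_)
open import Data.List.Relation.Unary.AllPairs using (AllPairs; []; _∷_)
open import Data.List.Relation.Unary.Any using (here; there)
open import Data.Nat using (ℕ; zero; suc; _≤_; _<_; s≤s; _⊔_)
open import Data.Nat.Properties
  using (≤-refl; ≤-reflexive; ≤-<-trans; <⇒≤; m≤n⇒m≤1+n; m≤m⊔n; m≤n⊔m; _≤?_; ≰⇒>; n≮0; n≢0⇒n>0; ≡-irrelevant)
open import Data.Product using (∃; _,_; proj₁; proj₂)
open import Data.Sum using (_⊎_; inj₁; inj₂)
open import Data.Vec.Base using ([]; _∷_; here; there)
open import Relation.Binary.PropositionalEquality as ≡ using (_≡_; _≢_; cong)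
import Relation.Binary.Reasoning.Setoid
open import Relation.Nullary using (¬_; yes; no)
open import Defs

data Odd : ℕ → Set where
  odd-1  : Odd 1
  odd-2+ : ∀ {n} → Odd n → Odd (suc (suc n))

odd⊎odd-suc : ∀ n → Odd n ⊎ Odd (suc n)
odd⊎odd-suc zero    = inj₂ odd-1
odd⊎odd-suc (suc n) with odd⊎odd-suc n
... | inj₁ odd-n     = inj₂ (odd-2+ odd-n)
... | inj₂ odd-suc-n = inj₁ odd-suc-n

module CoefficientSequences {c ℓ : Level} (R : CommutativeRing c ℓ) where
  open CommutativeRing R hiding (zero)
  open import Algebra.Properties.Ring ring using (+-cancelʳ)
  open import Algebra.Properties.Semiring.Mult semiring using (_×_; ×-congʳ; ×-homo-1; ×-comm-*)
  open import Algebra.Properties.CommutativeMonoid.Mult +-commutativeMonoid using (×-distrib-+)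
  open import Algebra.Solver.Ring.NaturalCoefficients.Default commutativeSemiring
  open import Relation.Binary.Reasoning.Setoid setoid

  Poly : Set c
  Poly = ℕ → Carrier

  infix 4 _≋_ _≋[_]_

  _≋_ : Poly → Poly → Set ℓ
  f ≋ g = ∀ n → f n ≈ g n

  -- congruence modulo t ^ (r + 1)
  _≋[_]_ : Poly → ℕ → Poly → Set ℓ
  f ≋[ r ] g = ∀ n → n ≤ r → f n ≈ g n

  one : Poly
  one zero    = 1#
  one (suc _) = 0#

  -- the product (1 + a t) f
  mulLinear : Carrier → Poly → Poly
  mulLinear a f zero    = f zero
  mulLinear a f (suc n) = f (suc n) + a * f n

  mulLinears : List Carrier → Poly → Poly
  mulLinears []      f = f
  mulLinears (a ∷ l) f = mulLinear a (mulLinears l f)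

  esymPoly : List Carrier → Poly
  esymPoly l = mulLinears l one

  mulLinear-cong : ∀ a {f g} → f ≋ g → mulLinear a f ≋ mulLinear a g
  mulLinear-cong a f≋g zero    = f≋g zero
  mulLinear-cong a f≋g (suc n) = +-cong (f≋g (suc n)) (*-congˡ (f≋g n))

  mulLinear-comm : ∀ a b f → mulLinear a (mulLinear b f) ≋ mulLinear b (mulLinear a f)
  mulLinear-comm a b f zero          = refl
  mulLinear-comm a b f (suc zero)    =
    solve 4 (λ a b f₀ f₁ → (f₁ :+ b :* f₀) :+ a :* f₀ := (f₁ :+ a :* f₀) :+ b :* f₀) refl
      a b (f 0) (f 1)
  mulLinear-comm a b f (suc (suc n)) =
    solve 5 (λ a b f₀ f₁ f₂ → (f₂ :+ b :* f₁) :+ a :* (f₁ :+ b :* f₀)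
                            := (f₂ :+ a :* f₁) :+ b :* (f₁ :+ a :* f₀)) refl
      a b (f n) (f (suc n)) (f (suc (suc n)))

  mulLinears-cong : ∀ l {f g} → f ≋ g → mulLinears l f ≋ mulLinears l g
  mulLinears-cong []      f≋g = f≋g
  mulLinears-cong (a ∷ l) f≋g = mulLinear-cong a (mulLinears-cong l f≋g)

  mulLinears-mulLinear : ∀ l a f → mulLinears l (mulLinear a f) ≋ mulLinear a (mulLinears l f)
  mulLinears-mulLinear []      a f n = refl
  mulLinears-mulLinear (b ∷ l) a f n =
    trans (mulLinear-cong b (mulLinears-mulLinear l a f) n) (mulLinear-comm b a (mulLinears l f) n)

  mulLinears-comm : ∀ l m f → mulLinears l (mulLinears m f) ≋ mulLinears m (mulLinears l f)
  mulLinears-comm []      m f n = refl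
  mulLinears-comm (a ∷ l) m f n =
    trans (mulLinear-cong a (mulLinears-comm l m f) n) (sym (mulLinears-mulLinear m a (mulLinears l f) n))

  mulLinear-cong≤ : ∀ a {f g r} → f ≋[ r ] g → mulLinear a f ≋[ r ] mulLinear a g
  mulLinear-cong≤ a f≋g zero    n≤r = f≋g zero n≤r
  mulLinear-cong≤ a f≋g (suc n) n<r = +-cong (f≋g (suc n) n<r) (*-congˡ (f≋g n (<⇒≤ n<r)))

  mulLinears-cong≤ : ∀ l {f g r} → f ≋[ r ] g → mulLinears l f ≋[ r ] mulLinears l g
  mulLinears-cong≤ []      f≋g = f≋g
  mulLinears-cong≤ (a ∷ l) f≋g = mulLinear-cong≤ a (mulLinears-cong≤ l f≋g)

  -- 1 + a t is invertible modulo t ^ (r + 1)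
  mulLinear-cancel≤ : ∀ a {f g r} → mulLinear a f ≋[ r ] mulLinear a g → f ≋[ r ] g
  mulLinear-cancel≤ a af≋ag zero    n≤r = af≋ag zero n≤r
  mulLinear-cancel≤ a {f} {g} af≋ag (suc n) n<r = +-cancelʳ _ _ _ (begin
    f (suc n) + a * f n ≈⟨ af≋ag (suc n) n<r ⟩
    g (suc n) + a * g n ≈⟨ +-congˡ (*-congˡ (sym (mulLinear-cancel≤ a af≋ag n (<⇒≤ n<r)))) ⟩
    g (suc n) + a * f n ∎)

  mulLinears-cancel≤ : ∀ l {f g r} → mulLinears l f ≋[ r ] mulLinears l g → f ≋[ r ] g
  mulLinears-cancel≤ []      lf≋lg = lf≋lg
  mulLinears-cancel≤ (a ∷ l) lf≋lg = mulLinears-cancel≤ l (mulLinear-cancel≤ a lf≋lg)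

  ≋[]⇒≋ : ∀ {f g r} → f ≋[ r ] g → (∀ n → r < n → f n ≈ 0#) → (∀ n → r < n → g n ≈ 0#) → f ≋ g
  ≋[]⇒≋ {r = r} f≋g f-high g-high n with n ≤? r
  ... | yes n≤r = f≋g n n≤r
  ... | no  n≰r = trans (f-high n (≰⇒> n≰r)) (sym (g-high n (≰⇒> n≰r)))

  mulLinear-zero : ∀ {a} f → a ≈ 0# → mulLinear a f ≋ f
  mulLinear-zero f a≈0 zero    = refl
  mulLinear-zero f a≈0 (suc n) = trans (+-congˡ (trans (*-congʳ a≈0) (zeroˡ _))) (+-identityʳ _)

  esymPoly-constant : ∀ l → esymPoly l 0 ≈ 1#
  esymPoly-constant []      = refl
  esymPoly-constant (a ∷ l) = esymPoly-constant l

  esymPoly-vanishes : ∀ l {n} → length l < n → esymPoly l n ≈ 0#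
  esymPoly-vanishes []      {suc n} _         = refl
  esymPoly-vanishes (a ∷ l) {suc n} (s≤s l<n) = begin
    esymPoly l (suc n) + a * esymPoly l n
      ≈⟨ +-cong (esymPoly-vanishes l (m≤n⇒m≤1+n l<n)) (*-congˡ (esymPoly-vanishes l l<n)) ⟩
    0# + a * 0# ≈⟨ +-identityˡ _ ⟩
    a * 0#      ≈⟨ zeroʳ a ⟩
    0#          ∎

  deriv : Poly → Poly
  deriv f n = suc n × f (suc n)

  deriv-cong : ∀ {f g} → f ≋ g → deriv f ≋ deriv g
  deriv-cong f≋g n = ×-congʳ (suc n) (f≋g (suc n))

  deriv-vanishes : ∀ f n → f (suc n) ≈ 0# → deriv f n ≈ 0#
  deriv-vanishes f n fn≈0 = trans (×-congʳ (suc n) fn≈0) (×-zeroʳ (suc n))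
    where
    ×-zeroʳ : ∀ m → m × 0# ≈ 0#
    ×-zeroʳ zero    = refl
    ×-zeroʳ (suc m) = trans (+-identityˡ _) (×-zeroʳ m)

  deriv-mulLinear : ∀ a f n → deriv (mulLinear a f) n ≈ mulLinear a (deriv f) n + a * f n
  deriv-mulLinear a f zero    = trans (×-homo-1 _) (+-congʳ (sym (×-homo-1 _)))
  deriv-mulLinear a f (suc n) = begin
    suc (suc n) × (f (suc (suc n)) + a * f (suc n))
      ≈⟨ ×-distrib-+ (f (suc (suc n))) (a * f (suc n)) (suc (suc n)) ⟩
    suc (suc n) × f (suc (suc n)) + (a * f (suc n) + suc n × (a * f (suc n)))
      ≈⟨ +-congˡ (+-congˡ (sym (×-comm-* (suc n) a (f (suc n))))) ⟩
    suc (suc n) × f (suc (suc n)) + (a * f (suc n) + a * (suc n × f (suc n)))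
      ≈⟨ solve 3 (λ x y z → x :+ (y :+ z) := (x :+ z) :+ y) refl _ _ _ ⟩
    (suc (suc n) × f (suc (suc n)) + a * (suc n × f (suc n))) + a * f (suc n) ∎

  eval : ℕ → Poly → Carrier → Carrier
  eval zero    f x = 0#
  eval (suc N) f x = f 0 + x * eval N (λ n → f (suc n)) x

  eval-cong : ∀ N {f g} x → f ≋ g → eval N f x ≈ eval N g x
  eval-cong zero    x f≋g = refl
  eval-cong (suc N) x f≋g = +-cong (f≋g 0) (*-congˡ (eval-cong N x (λ n → f≋g (suc n))))

  eval-zero : ∀ N {f} x → f ≋ (λ _ → 0#) → eval N f x ≈ 0#
  eval-zero zero    x f≋0 = refl
  eval-zero (suc N) {f} x f≋0 = begin
    f 0 + x * eval N (λ n → f (suc n)) x ≈⟨ +-cong (f≋0 0) (*-congˡ (eval-zero N x (λ n → f≋0 (suc n)))) ⟩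
    0# + x * 0#                          ≈⟨ +-identityˡ _ ⟩
    x * 0#                               ≈⟨ zeroʳ x ⟩
    0#                                   ∎

  eval-+ : ∀ N f g x → eval N (λ n → f n + g n) x ≈ eval N f x + eval N g x
  eval-+ zero    f g x = sym (+-identityʳ 0#)
  eval-+ (suc N) f g x = begin
    (f 0 + g 0) + x * eval N (λ n → f (suc n) + g (suc n)) x
      ≈⟨ +-congˡ (*-congˡ (eval-+ N (λ n → f (suc n)) (λ n → g (suc n)) x)) ⟩
    (f 0 + g 0) + x * (eval N (λ n → f (suc n)) x + eval N (λ n → g (suc n)) x)
      ≈⟨ solve 5 (λ a b x u v → (a :+ b) :+ x :* (u :+ v) := (a :+ x :* u) :+ (b :+ x :* v)) refl _ _ _ _ _ ⟩
    (f 0 + x * eval N (λ n → f (suc n)) x) + (g 0 + x * eval N (λ n → g (suc n)) x) ∎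

  eval-scale : ∀ N a f x → eval N (λ n → a * f n) x ≈ a * eval N f x
  eval-scale zero    a f x = sym (zeroʳ a)
  eval-scale (suc N) a f x = begin
    a * f 0 + x * eval N (λ n → a * f (suc n)) x ≈⟨ +-congˡ (*-congˡ (eval-scale N a (λ n → f (suc n)) x)) ⟩
    a * f 0 + x * (a * eval N (λ n → f (suc n)) x)
      ≈⟨ solve 4 (λ a b x e → a :* b :+ x :* (a :* e) := a :* (b :+ x :* e)) refl _ _ _ _ ⟩
    a * (f 0 + x * eval N (λ n → f (suc n)) x) ∎

  eval-extend : ∀ N f x → f N ≈ 0# → eval (suc N) f x ≈ eval N f x
  eval-extend zero    f x f0≈0 = trans (+-cong f0≈0 (zeroʳ x)) (+-identityˡ 0#)
  eval-extend (suc N) f x fN≈0 = +-congˡ (*-congˡ (eval-extend N (λ n → f (suc n)) x fN≈0))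

  eval-mulLinear : ∀ N a f x → f N ≈ 0# → eval (suc N) (mulLinear a f) x ≈ (1# + a * x) * eval N f x
  eval-mulLinear N a f x fN≈0 = begin
    f 0 + x * eval N (λ n → f (suc n) + a * f n) x
      ≈⟨ +-congˡ (*-congˡ (trans (eval-+ N (λ n → f (suc n)) (λ n → a * f n) x)
                                 (+-congˡ (eval-scale N a f x)))) ⟩
    f 0 + x * (eval N (λ n → f (suc n)) x + a * eval N f x)
      ≈⟨ solve 5 (λ a x f₀ e e′ → f₀ :+ x :* (e :+ a :* e′) := (f₀ :+ x :* e) :+ (a :* x) :* e′) refl
           a x (f 0) (eval N (λ n → f (suc n)) x) (eval N f x) ⟩
    eval (suc N) f x + (a * x) * eval N f x ≈⟨ +-congʳ (eval-extend N f x fN≈0) ⟩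
    eval N f x + (a * x) * eval N f x
      ≈⟨ solve 3 (λ a x e → e :+ (a :* x) :* e := (con 1 :+ a :* x) :* e) refl a x (eval N f x) ⟩
    (1# + a * x) * eval N f x ∎

  linearProduct : List Carrier → Carrier → Carrier
  linearProduct []      x = 1#
  linearProduct (a ∷ l) x = (1# + a * x) * linearProduct l x

  eval-esymPoly : ∀ l {N} x → length l < N → eval N (esymPoly l) x ≈ linearProduct l x
  eval-esymPoly []      {suc N} x _         =
    trans (+-congˡ (trans (*-congˡ (eval-zero N x (λ _ → refl))) (zeroʳ x))) (+-identityʳ 1#)
  eval-esymPoly (a ∷ l) {suc N} x (s≤s l<N) = begin
    eval (suc N) (mulLinear a (esymPoly l)) x ≈⟨ eval-mulLinear N a (esymPoly l) x (esymPoly-vanishes l l<N) ⟩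
    (1# + a * x) * eval N (esymPoly l) x     ≈⟨ *-congˡ (eval-esymPoly l x l<N) ⟩
    (1# + a * x) * linearProduct l x         ∎

  deriv-esymPoly-atRoot : ∀ d l x → 1# + d * x ≈ 0# →
    eval (suc (length l)) (deriv (esymPoly (d ∷ l))) x ≈ d * linearProduct l x
  deriv-esymPoly-atRoot d l x root = begin
    eval (suc M) (deriv (mulLinear d g)) x
      ≈⟨ eval-cong (suc M) x (deriv-mulLinear d g) ⟩
    eval (suc M) (λ n → mulLinear d (deriv g) n + d * g n) x
      ≈⟨ eval-+ (suc M) (mulLinear d (deriv g)) (λ n → d * g n) x ⟩
    eval (suc M) (mulLinear d (deriv g)) x + eval (suc M) (λ n → d * g n) x
      ≈⟨ +-cong (eval-mulLinear M d (deriv g) x (deriv-vanishes g M (esymPoly-vanishes l ≤-refl)))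
                (eval-scale (suc M) d g x) ⟩
    (1# + d * x) * eval M (deriv g) x + d * eval (suc M) g x
      ≈⟨ +-cong (trans (*-congʳ root) (zeroˡ _)) (*-congˡ (eval-esymPoly l x ≤-refl)) ⟩
    0# + d * linearProduct l x
      ≈⟨ +-identityˡ _ ⟩
    d * linearProduct l x ∎
    where
    M = length l
    g = esymPoly l

module CharacteristicTwo {c ℓ : Level} (R : CommutativeRing c ℓ) (char2 : HasChar2 R) where
  open CommutativeRing R hiding (zero)
  open CoefficientSequences R
  open import Algebra.Properties.Semiring.Mult semiring using (_×_)
  open import Algebra.Solver.Ring.NaturalCoefficients.Default commutativeSemiring
  open import Relation.Binary.Reasoning.Setoid setoid

  x+x≈0 : ∀ x → x + x ≈ 0#
  x+x≈0 x = begin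
    x + x           ≈⟨ sym (+-cong (*-identityˡ x) (*-identityˡ x)) ⟩
    1# * x + 1# * x ≈⟨ sym (distribʳ x 1# 1#) ⟩
    (1# + 1#) * x   ≈⟨ *-congʳ char2 ⟩
    0# * x          ≈⟨ zeroˡ x ⟩
    0#              ∎

  odd-suc-×≈0 : ∀ {n} → Odd n → ∀ x → suc n × x ≈ 0#
  odd-suc-×≈0 odd-1        x = trans (+-congˡ (+-identityʳ x)) (x+x≈0 x)
  odd-suc-×≈0 (odd-2+ {n} odd-n) x = begin
    x + (x + suc n × x) ≈⟨ sym (+-assoc x x _) ⟩
    (x + x) + suc n × x ≈⟨ +-cong (x+x≈0 x) (odd-suc-×≈0 odd-n x) ⟩
    0# + 0#             ≈⟨ +-identityˡ 0# ⟩
    0#                  ∎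

  OddFree : ℕ → Poly → Set ℓ
  OddFree r f = ∀ {n} → Odd n → n ≤ r → f n ≈ 0#

  OddFree-resp : ∀ {r f g} → f ≋[ r ] g → OddFree r g → OddFree r f
  OddFree-resp f≋g odd-g odd-n n≤r = trans (f≋g _ n≤r) (odd-g odd-n n≤r)

  mulLinear-square : ∀ a f n →
    mulLinear a (mulLinear a f) (suc (suc n)) ≈ f (suc (suc n)) + (a * a) * f n
  mulLinear-square a f n = begin
    (f (suc (suc n)) + a * f (suc n)) + a * (f (suc n) + a * f n)
      ≈⟨ solve 4 (λ a f₀ f₁ f₂ → (f₂ :+ a :* f₁) :+ a :* (f₁ :+ a :* f₀)
                               := (f₂ :+ (a :* a) :* f₀) :+ (a :* f₁ :+ a :* f₁)) refl _ _ _ _ ⟩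
    (f (suc (suc n)) + (a * a) * f n) + (a * f (suc n) + a * f (suc n))
      ≈⟨ +-congˡ (x+x≈0 (a * f (suc n))) ⟩
    (f (suc (suc n)) + (a * a) * f n) + 0#
      ≈⟨ +-identityʳ _ ⟩
    f (suc (suc n)) + (a * a) * f n ∎

  mulLinear-square-oddFree : ∀ {r} a f → OddFree r (mulLinear a (mulLinear a f)) → OddFree r f
  mulLinear-square-oddFree a f odd-aaf odd-1 1≤r = begin
    f 1                         ≈⟨ sym (+-identityʳ _) ⟩
    f 1 + 0#                    ≈⟨ +-congˡ (sym (x+x≈0 (a * f 0))) ⟩
    f 1 + (a * f 0 + a * f 0)   ≈⟨ sym (+-assoc _ _ _) ⟩
    (f 1 + a * f 0) + a * f 0   ≈⟨ odd-aaf odd-1 1≤r ⟩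
    0#                          ∎
  mulLinear-square-oddFree a f odd-aaf (odd-2+ {n} odd-n) n+2≤r = begin
    f (suc (suc n))                  ≈⟨ sym (+-identityʳ _) ⟩
    f (suc (suc n)) + 0#             ≈⟨ +-congˡ (sym (zeroʳ (a * a))) ⟩
    f (suc (suc n)) + (a * a) * 0#
      ≈⟨ +-congˡ (*-congˡ (sym (mulLinear-square-oddFree a f odd-aaf odd-n n≤r))) ⟩
    f (suc (suc n)) + (a * a) * f n  ≈⟨ sym (mulLinear-square a f n) ⟩
    mulLinear a (mulLinear a f) (suc (suc n)) ≈⟨ odd-aaf (odd-2+ odd-n) n+2≤r ⟩
    0#                               ∎
    where n≤r = <⇒≤ (<⇒≤ n+2≤r)

  mulLinears-square-oddFree : ∀ {r} l f → OddFree r (mulLinears l (mulLinears l f)) → OddFree r f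
  mulLinears-square-oddFree []      f odd-llf = odd-llf
  mulLinears-square-oddFree (a ∷ l) f odd-llf =
    mulLinears-square-oddFree l f (mulLinear-square-oddFree a (mulLinears l (mulLinears l f))
      (OddFree-resp (λ n _ → mulLinear-cong a (λ m → sym (mulLinears-mulLinear l a (mulLinears l f) m)) n)
        odd-llf))

  -- in characteristic 2, f' n = (n + 1) f (n + 1) only sees the odd coefficients
  oddFree⇒deriv≋0 : ∀ {r} f → OddFree r f → (∀ n → r < n → f n ≈ 0#) → deriv f ≋ (λ _ → 0#)
  oddFree⇒deriv≋0 {r} f odd-f high-f n with odd⊎odd-suc n | suc n ≤? r
  ... | inj₁ odd-n     | _           = odd-suc-×≈0 odd-n (f (suc n))
  ... | inj₂ odd-suc-n | yes suc-n≤r = deriv-vanishes f n (odd-f odd-suc-n suc-n≤r)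
  ... | inj₂ _         | no  suc-n≰r = deriv-vanishes f n (high-f (suc n) (≰⇒> suc-n≰r))

module FieldRoots {c ℓ : Level} (F : CommutativeRing c ℓ) (isField : IsField F) where
  open CommutativeRing F hiding (zero)
  open IsField isField
  open CoefficientSequences F
  open import Algebra.Properties.Ring ring using (+-inverseʳ-unique; -‿distribʳ-*)
  open import Relation.Binary.Reasoning.Setoid setoid

  *-cancelʳ-≉0 : ∀ {c x y} → c ≉ 0# → x * c ≈ y * c → x ≈ y
  *-cancelʳ-≉0 {c} {x} {y} c≉0 xc≈yc with inverse c c≉0
  ... | c⁻¹ , cc⁻¹≈1 = begin
    x              ≈⟨ sym (*-identityʳ x) ⟩
    x * 1#         ≈⟨ *-congˡ (sym cc⁻¹≈1) ⟩
    x * (c * c⁻¹)  ≈⟨ sym (*-assoc x c c⁻¹) ⟩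
    (x * c) * c⁻¹  ≈⟨ *-congʳ xc≈yc ⟩
    (y * c) * c⁻¹  ≈⟨ *-assoc y c c⁻¹ ⟩
    y * (c * c⁻¹)  ≈⟨ *-congˡ cc⁻¹≈1 ⟩
    y * 1#         ≈⟨ *-identityʳ y ⟩
    y              ∎

  *-≉0 : ∀ {x y} → x ≉ 0# → y ≉ 0# → x * y ≉ 0#
  *-≉0 {x} {y} x≉0 y≉0 xy≈0 = y≉0 (*-cancelʳ-≉0 x≉0 (trans (*-comm y x) (trans xy≈0 (sym (zeroˡ x)))))

  linearRoot : ∀ {a} → a ≉ 0# → ∃ λ c → 1# + a * c ≈ 0#
  linearRoot {a} a≉0 with inverse a a≉0
  ... | a⁻¹ , aa⁻¹≈1 = - a⁻¹ , (begin
    1# + a * - a⁻¹   ≈⟨ +-congˡ (sym (-‿distribʳ-* a a⁻¹)) ⟩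
    1# + - (a * a⁻¹) ≈⟨ +-congˡ (-‿cong aa⁻¹≈1) ⟩
    1# + - 1#        ≈⟨ -‿inverseʳ 1# ⟩
    0#               ∎)

  linearRoot-unique : ∀ {a b c} → 1# + a * c ≈ 0# → 1# + b * c ≈ 0# → a ≈ b
  linearRoot-unique {a} {b} {c} a-root b-root = *-cancelʳ-≉0 c≉0
    (trans (+-inverseʳ-unique 1# (a * c) a-root) (sym (+-inverseʳ-unique 1# (b * c) b-root)))
    where
    c≉0 : c ≉ 0#
    c≉0 c≈0 = nontrivial (begin
      1#          ≈⟨ sym (+-identityʳ 1#) ⟩
      1# + 0#     ≈⟨ +-congˡ (sym (trans (*-congˡ c≈0) (zeroʳ a))) ⟩
      1# + a * c  ≈⟨ a-root ⟩
      0#          ∎)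

  linearProduct-≈0 : ∀ {a c l} → 1# + a * c ≈ 0# → a List.∈ l → linearProduct l c ≈ 0#
  linearProduct-≈0 root (here ≡.refl) = trans (*-congʳ root) (zeroˡ _)
  linearProduct-≈0 root (there a∈l) = trans (*-congˡ (linearProduct-≈0 root a∈l)) (zeroʳ _)

  linearProduct-≉0 : ∀ {a c l} → 1# + a * c ≈ 0# → All (a ≉_) l → linearProduct l c ≉ 0#
  linearProduct-≉0 root []          = nontrivial
  linearProduct-≉0 root (a≉b ∷ a∉l) =
    *-≉0 (λ b-root → a≉b (linearRoot-unique root b-root)) (linearProduct-≉0 root a∉l)

  -- evaluate both sides at the root of 1 + a t
  esymPoly-≉ : ∀ {a l l′} → a ≉ 0# → a List.∈ l → All (a ≉_) l′ → ¬ esymPoly l ≋ esymPoly l′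
  esymPoly-≉ {a} {l} {l′} a≉0 a∈l a∉l′ l≋l′ with linearRoot a≉0
  ... | c , root = linearProduct-≉0 root a∉l′ (begin
    linearProduct l′ c ≈⟨ sym (eval-esymPoly l′ c (s≤s (m≤n⊔m (length l) (length l′)))) ⟩
    eval N (esymPoly l′) c ≈⟨ sym (eval-cong N c l≋l′) ⟩
    eval N (esymPoly l) c  ≈⟨ eval-esymPoly l c (s≤s (m≤m⊔n (length l) (length l′))) ⟩
    linearProduct l c      ≈⟨ linearProduct-≈0 root a∈l ⟩
    0#                     ∎)
    where
    N = suc (length l ⊔ length l′)

  -- whether d ≈ 0# holds need not be decidable: refuting both cases is enough
  deriv-esymPoly-≉0 : ∀ l → AllPairs _≉_ l → ¬ All (_≈ 0#) l → ¬ deriv (esymPoly l) ≋ (λ _ → 0#)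
  deriv-esymPoly-≉0 []      _                 not-all-zero _    = not-all-zero []
  deriv-esymPoly-≉0 (d ∷ l) (d∉l ∷ distinct) not-all-zero d′≋0 = nonzero-case zero-case
    where
    zero-case : ¬ d ≈ 0#
    zero-case d≈0 = deriv-esymPoly-≉0 l distinct (λ l≈0 → not-all-zero (d≈0 ∷ l≈0))
      (λ n → trans (sym (deriv-cong (mulLinear-zero (esymPoly l) d≈0) n)) (d′≋0 n))

    nonzero-case : ¬ d ≉ 0#
    nonzero-case d≉0 with linearRoot d≉0
    ... | c , root = *-≉0 d≉0 (linearProduct-≉0 root d∉l) (begin
      d * linearProduct l c ≈⟨ sym (deriv-esymPoly-atRoot d l c root) ⟩
      eval (suc (length l)) (deriv (esymPoly (d ∷ l))) c ≈⟨ eval-zero (suc (length l)) c d′≋0 ⟩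
      0#                    ∎)

  distinct⇒¬All≈0 : ∀ l → AllPairs _≉_ l → 2 ≤ length l → ¬ All (_≈ 0#) l
  distinct⇒¬All≈0 (x ∷ y ∷ l) ((x≉y ∷ _) ∷ _) (s≤s (s≤s _)) (x≈0 ∷ y≈0 ∷ _) = x≉y (trans x≈0 (sym y≈0))

-- Imported only now: ℕ's _+_ and _*_ would clash with the ring operations opened in the modules above.
open import Data.Nat using (_+_; _*_; _^_; _∸_)
open import Data.Nat.Properties
  using (+-suc; +-identityʳ; *-suc; +-cancelʳ-≡; +-cancelˡ-≤; m+n∸m≡n; module ≤-Reasoning)

Odd⇒≡2*m+1 : ∀ {n} → Odd n → ∃ λ m → n ≡ 2 * m + 1
Odd⇒≡2*m+1 odd-1 = 0 , ≡.refl
Odd⇒≡2*m+1 (odd-2+ odd-n) with Odd⇒≡2*m+1 odd-n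
... | m , ≡.refl = suc m , cong (_+ 1) (≡.sym (*-suc 2 m))

2*k≡k+k : ∀ k → 2 * k ≡ k + k
2*k≡k+k k = cong (k +_) (+-identityʳ k)

Disjoint-tail : ∀ {n x y} {S T : Subset n} → Disjoint (x ∷ S) (y ∷ T) → Disjoint S T
Disjoint-tail S∩T=∅ i i∈S i∈T = S∩T=∅ (suc i) (there i∈S) (there i∈T)

select : ∀ {a} {A : Set a} {n} → Subset n → (Fin n → A) → List A
select []            X = []
select (inside ∷ S)  X = X zero ∷ select S (λ i → X (suc i))
select (outside ∷ S) X = select S (λ i → X (suc i))

length-select : ∀ {a} {A : Set a} {n} (S : Subset n) (X : Fin n → A) → length (select S X) ≡ ∣ S ∣
length-select []            X = ≡.refl
length-select (inside ∷ S)  X = cong suc (length-select S _)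
length-select (outside ∷ S) X = length-select S _

∈-select : ∀ {a} {A : Set a} {n} {S : Subset n} {i} (X : Fin n → A) → i ∈ S → X i List.∈ select S X
∈-select {S = inside ∷ S}  X here          = here ≡.refl
∈-select {S = inside ∷ S}  X (there i∈S)   = there (∈-select _ i∈S)
∈-select {S = outside ∷ S} X (there i∈S)   = ∈-select _ i∈S

All-select : ∀ {a p} {A : Set a} {P : A → Set p} {n} (S : Subset n) (X : Fin n → A) →
  (∀ {i} → i ∈ S → P (X i)) → All P (select S X)
All-select []            X P-X = []
All-select (inside ∷ S)  X P-X = P-X here ∷ All-select S _ (λ i∈S → P-X (there i∈S))
All-select (outside ∷ S) X P-X = All-select S _ (λ i∈S → P-X (there i∈S))

Disjoint-sym : ∀ {n} {S T : Subset n} → Disjoint S T → Disjoint T S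
Disjoint-sym S∩T=∅ i i∈T i∈S = S∩T=∅ i i∈S i∈T

Disjoint-⊆ʳ : ∀ {n} {S T U : Subset n} → U ⊆ T → Disjoint S T → Disjoint S U
Disjoint-⊆ʳ U⊆T S∩T=∅ i i∈S i∈U = S∩T=∅ i i∈S (U⊆T i∈U)

Disjoint-⊆ˡ : ∀ {n} {S T U : Subset n} → U ⊆ S → Disjoint S T → Disjoint U T
Disjoint-⊆ˡ U⊆S S∩T=∅ i i∈U i∈T = S∩T=∅ i (U⊆S i∈U) i∈T

Disjoint-∪ʳ : ∀ {n} {S T U : Subset n} → Disjoint S T → Disjoint S U → Disjoint S (T ∪ U)
Disjoint-∪ʳ {T = T} {U} S∩T=∅ S∩U=∅ i i∈S i∈T∪U with x∈p∪q⁻ T U i∈T∪U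
... | inj₁ i∈T = S∩T=∅ i i∈S i∈T
... | inj₂ i∈U = S∩U=∅ i i∈S i∈U

Disjoint-∁ : ∀ {n} (S : Subset n) → Disjoint S (∁ S)
Disjoint-∁ S i = x∈p⇒x∉∁p

Disjoint-─ : ∀ {n} (S T : Subset n) → Disjoint (S ─ T) T
Disjoint-─ (s ∷ S) (inside ∷ T)  (suc i) (there i∈S─T) (there i∈T) = Disjoint-─ S T i i∈S─T i∈T
Disjoint-─ (s ∷ S) (outside ∷ T) (suc i) (there i∈S─T) (there i∈T) = Disjoint-─ S T i i∈S─T i∈T

Disjoint-─-─ : ∀ {n} (S T : Subset n) → Disjoint (S ─ T) (T ─ S)
Disjoint-─-─ S T = Disjoint-⊆ʳ (p─q⊆p T S) (Disjoint-─ S T)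

∣∪∣ : ∀ {n} (S T : Subset n) → Disjoint S T → ∣ S ∪ T ∣ ≡ ∣ S ∣ + ∣ T ∣
∣∪∣ []            []            S∩T=∅ = ≡.refl
∣∪∣ (inside ∷ S)  (inside ∷ T)  S∩T=∅ = ⊥-elim (S∩T=∅ zero here here)
∣∪∣ (inside ∷ S)  (outside ∷ T) S∩T=∅ = cong suc (∣∪∣ S T (Disjoint-tail S∩T=∅))
∣∪∣ (outside ∷ S) (inside ∷ T)  S∩T=∅ =
  ≡.trans (cong suc (∣∪∣ S T (Disjoint-tail S∩T=∅))) (≡.sym (+-suc ∣ S ∣ ∣ T ∣))
∣∪∣ (outside ∷ S) (outside ∷ T) S∩T=∅ = ∣∪∣ S T (Disjoint-tail S∩T=∅)

≡─∪∩ : ∀ {n} (S T : Subset n) → S ≡ (S ─ T) ∪ (S ∩ T)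
≡─∪∩ []            []            = ≡.refl
≡─∪∩ (inside ∷ S)  (inside ∷ T)  = cong (inside ∷_) (≡─∪∩ S T)
≡─∪∩ (inside ∷ S)  (outside ∷ T) = cong (inside ∷_) (≡─∪∩ S T)
≡─∪∩ (outside ∷ S) (inside ∷ T)  = cong (outside ∷_) (≡─∪∩ S T)
≡─∪∩ (outside ∷ S) (outside ∷ T) = cong (outside ∷_) (≡─∪∩ S T)

Disjoint-─-∩ : ∀ {n} (S T : Subset n) → Disjoint (S ─ T) (S ∩ T)
Disjoint-─-∩ S T = Disjoint-⊆ʳ (p∩q⊆q S T) (Disjoint-─ S T)

∣─∣+∣∩∣ : ∀ {n} (S T : Subset n) → ∣ S ─ T ∣ + ∣ S ∩ T ∣ ≡ ∣ S ∣
∣─∣+∣∩∣ S T = ≡.trans (≡.sym (∣∪∣ (S ─ T) (S ∩ T) (Disjoint-─-∩ S T))) (cong ∣_∣ (≡.sym (≡─∪∩ S T)))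

∣∣≡0⇒∉ : ∀ {n} {S : Subset n} {i : Fin n} → ∣ S ∣ ≡ 0 → i ∉ S
∣∣≡0⇒∉ {S = S} {i} ∣S∣≡0 i∈S = n≮0 (≡.subst (∣ S - i ∣ <_) ∣S∣≡0 (x∈p⇒∣p-x∣<∣p∣ i∈S))

∣─∣≡0⇒⊆ : ∀ {n} {S T : Subset n} → ∣ S ─ T ∣ ≡ 0 → S ⊆ T
∣─∣≡0⇒⊆ {T = T} ∣S─T∣≡0 {i} i∈S with i ∈? T
... | yes i∈T = i∈T
... | no  i∉T = ⊥-elim (∣∣≡0⇒∉ ∣S─T∣≡0 (x∈p∧x∉q⇒x∈p─q i∈S i∉T))

∣∣>0⇒Nonempty : ∀ {n} (S : Subset n) → 0 < ∣ S ∣ → Nonempty S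
∣∣>0⇒Nonempty (inside ∷ S)  _      = zero , here
∣∣>0⇒Nonempty (outside ∷ S) ∣S∣>0 with ∣∣>0⇒Nonempty S ∣S∣>0
... | i , i∈S = suc i , there i∈S

∣─∣≡∣─∣ : ∀ {n} (S T : Subset n) → ∣ S ∣ ≡ ∣ T ∣ → ∣ S ─ T ∣ ≡ ∣ T ─ S ∣
∣─∣≡∣─∣ S T ∣S∣≡∣T∣ = +-cancelʳ-≡ _ ∣ S ─ T ∣ ∣ T ─ S ∣ (begin
  ∣ S ─ T ∣ + ∣ S ∩ T ∣  ≡⟨ ∣─∣+∣∩∣ S T ⟩
  ∣ S ∣                  ≡⟨ ∣S∣≡∣T∣ ⟩
  ∣ T ∣                  ≡⟨ ∣─∣+∣∩∣ T S ⟨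
  ∣ T ─ S ∣ + ∣ T ∩ S ∣  ≡⟨ cong (λ U → ∣ T ─ S ∣ + ∣ U ∣) (∩-comm T S) ⟩
  ∣ T ─ S ∣ + ∣ S ∩ T ∣  ∎)
  where open ≡.≡-Reasoning

─-nonempty : ∀ {n} (S T : Subset n) → ∣ S ∣ ≡ ∣ T ∣ → S ≢ T → Nonempty (S ─ T)
─-nonempty S T ∣S∣≡∣T∣ S≢T = ∣∣>0⇒Nonempty (S ─ T) (n≢0⇒n>0 (λ ∣S─T∣≡0 →
  S≢T (⊆-antisym (∣─∣≡0⇒⊆ ∣S─T∣≡0) (∣─∣≡0⇒⊆ {S = T} (≡.trans (≡.sym (∣─∣≡∣─∣ S T ∣S∣≡∣T∣)) ∣S─T∣≡0)))))

module SelectedFactors {c ℓ : Level} (R : CommutativeRing c ℓ) where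
  open CommutativeRing R hiding (zero)
  open CoefficientSequences R

  mulLinears-select-∪ : ∀ {n} (S T : Subset n) X f → Disjoint S T →
    mulLinears (select (S ∪ T) X) f ≋ mulLinears (select S X) (mulLinears (select T X) f)
  mulLinears-select-∪ []            []            X f S∩T=∅ = λ _ → refl
  mulLinears-select-∪ (inside ∷ S)  (inside ∷ T)  X f S∩T=∅ = ⊥-elim (S∩T=∅ zero here here)
  mulLinears-select-∪ (inside ∷ S)  (outside ∷ T) X f S∩T=∅ =
    mulLinear-cong (X zero) (mulLinears-select-∪ S T _ f (Disjoint-tail S∩T=∅))
  mulLinears-select-∪ (outside ∷ S) (inside ∷ T)  X f S∩T=∅ n = trans
    (mulLinear-cong (X zero) (mulLinears-select-∪ S T _ f (Disjoint-tail S∩T=∅)) n)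
    (sym (mulLinears-mulLinear (select S _) (X zero) (mulLinears (select T _) f) n))
  mulLinears-select-∪ (outside ∷ S) (outside ∷ T) X f S∩T=∅ =
    mulLinears-select-∪ S T _ f (Disjoint-tail S∩T=∅)

  esym≈esymPoly-select : ∀ n X i → esym R n X i ≈ esymPoly (select ⊤ X) i
  esym≈esymPoly-select zero    X zero    = refl
  esym≈esymPoly-select zero    X (suc i) = refl
  esym≈esymPoly-select (suc n) X zero    = sym (esymPoly-constant (select ⊤ (λ i → X (suc i))))
  esym≈esymPoly-select (suc n) X (suc i) =
    +-cong (esym≈esymPoly-select n _ (suc i)) (*-congˡ (esym≈esymPoly-select n _ i))

  select-distinct : ∀ {n} (S : Subset n) X → DistinctFamily R n X → AllPairs _≉_ (select S X)
  select-distinct []            X X-inj = []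
  select-distinct (inside ∷ S)  X X-inj =
    All-select S _ (λ _ X₀≈Xᵢ₊₁ → 0≢1+n (X-inj zero (suc _) X₀≈Xᵢ₊₁))
      ∷ select-distinct S _ (λ i j Xᵢ≈Xⱼ → suc-injective (X-inj (suc i) (suc j) Xᵢ≈Xⱼ))
  select-distinct (outside ∷ S) X X-inj =
    select-distinct S _ (λ i j Xᵢ≈Xⱼ → suc-injective (X-inj (suc i) (suc j) Xᵢ≈Xⱼ))

  select-∉ : ∀ {n} {S : Subset n} {i} X → DistinctFamily R n X → i ∉ S → All (X i ≉_) (select S X)
  select-∉ {S = S} {i} X X-inj i∉S =
    All-select S X (λ j∈S Xᵢ≈Xⱼ → i∉S (≡.subst (_∈ S) (≡.sym (X-inj i _ Xᵢ≈Xⱼ)) j∈S))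

module KneserSquareColouring
  {c ℓ : Level} (F : CommutativeRing c ℓ) (isField : IsField F) (char2 : HasChar2 F)
  {q : ℕ} (card : HasCardinality F q) (k r : ℕ) (2≤r : 2 ≤ r)
  (X : Fin (2 * k + r) → CommutativeRing.Carrier F) (X-inj : DistinctFamily F (2 * k + r) X)
  (X-oddFree : ∀ m → 2 * m + 1 ≤ r →
    CommutativeRing._≈_ F (esym F (2 * k + r) X (2 * m + 1)) (CommutativeRing.0# F))
  where

  open CommutativeRing F using (Carrier; _≈_; _≉_; 0#; sym; trans; reflexive; setoid)
  open CoefficientSequences F
  open CharacteristicTwo F char2
  open FieldRoots F isField
  open SelectedFactors F
  open HasCardinality card using (enum; enum-surj)
  module ≈-Reasoning = Relation.Binary.Reasoning.Setoid setoid

  N : ℕ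
  N = 2 * k + r

  esymOf : Subset N → Poly
  esymOf S = esymPoly (select S X)

  index : Carrier → Fin q
  index x = proj₁ (enum-surj x)

  index-injective : ∀ {x y} → index x ≡ index y → x ≈ y
  index-injective {x} {y} eq =
    trans (sym (proj₂ (enum-surj x))) (trans (reflexive (cong enum eq)) (proj₂ (enum-surj y)))

  -- coordinate i of the colour of S encodes e_(i+1) (X_S)
  coefficientIndices : Subset N → Fin r → Fin q
  coefficientIndices S i = index (esymOf S (suc (toℕ i)))

  coefficientColour : Subset N → Fin (q ^ r)
  coefficientColour S = funToFin (coefficientIndices S)

  coefficientColour-≡ : ∀ S T → coefficientColour S ≡ coefficientColour T → esymOf S ≋[ r ] esymOf T
  coefficientColour-≡ S T _ zero _ =
    trans (esymPoly-constant (select S X)) (sym (esymPoly-constant (select T X)))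
  coefficientColour-≡ S T same (suc m) m<r =
    ≡.subst (λ j → esymOf S (suc j) ≈ esymOf T (suc j)) (toℕ-fromℕ< m<r) (index-injective (begin
      coefficientIndices S i                  ≡⟨ finToFun-funToFin (coefficientIndices S) i ⟨
      finToFun {q} {r} (coefficientColour S) i ≡⟨ cong (λ colour → finToFun {q} {r} colour i) same ⟩
      finToFun {q} {r} (coefficientColour T) i ≡⟨ finToFun-funToFin (coefficientIndices T) i ⟩
      coefficientIndices T i                  ∎))
    where
    open ≡.≡-Reasoning
    i = fromℕ< m<r

  esymOf-⊤-oddFree : OddFree r (esymOf ⊤)
  esymOf-⊤-oddFree odd-n n≤r with Odd⇒≡2*m+1 odd-n
  ... | m , ≡.refl = trans (sym (esym≈esymPoly-select N X (2 * m + 1))) (X-oddFree m n≤r)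

  esymOf-vanishes : ∀ S {m} → ∣ S ∣ ≤ m → ∀ n → m < n → esymOf S n ≈ 0#
  esymOf-vanishes S ∣S∣≤m n m<n =
    esymPoly-vanishes (select S X) (≤-<-trans (≤-reflexive (length-select S X)) (≤-<-trans ∣S∣≤m m<n))

  esymOf-split : ∀ S T → esymOf S ≋ mulLinears (select (S ∩ T) X) (esymOf (S ─ T))
  esymOf-split S T n = begin
    esymOf S n
      ≡⟨ cong (λ U → esymOf U n) (≡─∪∩ S T) ⟩
    esymOf ((S ─ T) ∪ (S ∩ T)) n
      ≈⟨ mulLinears-select-∪ (S ─ T) (S ∩ T) X one (Disjoint-─-∩ S T) n ⟩
    mulLinears (select (S ─ T) X) (esymOf (S ∩ T)) n
      ≈⟨ mulLinears-comm (select (S ─ T) X) (select (S ∩ T) X) one n ⟩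
    mulLinears (select (S ∩ T) X) (esymOf (S ─ T)) n ∎
    where open ≈-Reasoning

  ∣∪∣≡k+k : ∀ {S T : Subset N} → ∣ S ∣ ≡ k → ∣ T ∣ ≡ k → Disjoint S T → ∣ S ∪ T ∣ ≡ k + k
  ∣∪∣≡k+k {S} {T} ∣S∣≡k ∣T∣≡k S∩T=∅ = ≡.trans (∣∪∣ S T S∩T=∅) (≡.cong₂ _+_ ∣S∣≡k ∣T∣≡k)

  ∣∁∣≡r : ∀ S → ∣ S ∣ ≡ k + k → ∣ ∁ S ∣ ≡ r
  ∣∁∣≡r S ∣S∣≡k+k = begin
    ∣ ∁ S ∣             ≡⟨ ∣∁p∣≡n∸∣p∣ S ⟩
    2 * k + r ∸ ∣ S ∣   ≡⟨ ≡.cong₂ _∸_ (cong (_+ r) (2*k≡k+k k)) ∣S∣≡k+k ⟩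
    k + k + r ∸ (k + k) ≡⟨ m+n∸m≡n (k + k) r ⟩
    r                   ∎
    where open ≡.≡-Reasoning

  disjoint-∣∣≤r : ∀ S T → ∣ S ∣ ≡ k + k → Disjoint S T → ∣ T ∣ ≤ r
  disjoint-∣∣≤r S T ∣S∣≡k+k S∩T=∅ = +-cancelˡ-≤ (k + k) ∣ T ∣ r (begin
    k + k + ∣ T ∣   ≡⟨ cong (_+ ∣ T ∣) ∣S∣≡k+k ⟨
    ∣ S ∣ + ∣ T ∣   ≡⟨ ∣∪∣ S T S∩T=∅ ⟨
    ∣ S ∪ T ∣       ≤⟨ ∣p∣≤n (S ∪ T) ⟩
    2 * k + r       ≡⟨ cong (_+ r) (2*k≡k+k k) ⟩
    k + k + r       ∎)
    where open ≤-Reasoning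

  -- the root of 1 + X_i t for a nonzero X_i, with i in S or in T, separates the two polynomials
  disjoint-esymOf-≉ : ∀ {S T : Subset N} → Disjoint S T → Nonempty S → Nonempty T → ¬ esymOf S ≋ esymOf T
  disjoint-esymOf-≉ {S} {T} S∩T=∅ (i , i∈S) (j , j∈T) S≋T =
    root-separates i∈S S∩T=∅ S≋T (λ Xᵢ≈0 →
      root-separates j∈T (Disjoint-sym S∩T=∅) (λ n → sym (S≋T n)) (λ Xⱼ≈0 →
        S∩T=∅ i i∈S (≡.subst (_∈ T) (≡.sym (X-inj i j (trans Xᵢ≈0 (sym Xⱼ≈0)))) j∈T)))
    where
    root-separates : ∀ {U V : Subset N} {i} → i ∈ U → Disjoint U V → esymOf U ≋ esymOf V → ¬ X i ≉ 0#
    root-separates i∈U U∩V=∅ U≋V Xᵢ≉0 =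
      esymPoly-≉ Xᵢ≉0 (∈-select X i∈U) (select-∉ X X-inj (U∩V=∅ _ i∈U)) U≋V

  -- for the r points D outside A ∪ B, P_A² P_D ≡ P_A P_B P_D = P_X mod t^(r+1)
  disjoint-case : ∀ A B → ∣ A ∣ ≡ k → ∣ B ∣ ≡ k → Disjoint A B → ¬ esymOf A ≋[ r ] esymOf B
  disjoint-case A B ∣A∣≡k ∣B∣≡k A∩B=∅ A≋B =
    deriv-esymPoly-≉0 (select D X) D-distinct
      (distinct⇒¬All≈0 (select D X) D-distinct (≡.subst (2 ≤_) (≡.sym ∣select-D∣≡r) 2≤r))
      (oddFree⇒deriv≋0 (esymOf D) D-oddFree (esymOf-vanishes D (≤-reflexive ∣D∣≡r)))
    where
    D = ∁ (A ∪ B)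
    D-distinct = select-distinct D X X-inj

    ∣D∣≡r : ∣ D ∣ ≡ r
    ∣D∣≡r = ∣∁∣≡r (A ∪ B) (∣∪∣≡k+k ∣A∣≡k ∣B∣≡k A∩B=∅)

    ∣select-D∣≡r : length (select D X) ≡ r
    ∣select-D∣≡r = ≡.trans (length-select D X) ∣D∣≡r

    B·D≈A·D : mulLinears (select B X) (esymOf D) ≋[ r ] mulLinears (select A X) (esymOf D)
    B·D≈A·D n n≤r = begin
      mulLinears (select B X) (esymOf D) n ≈⟨ mulLinears-comm (select B X) (select D X) one n ⟩
      mulLinears (select D X) (esymOf B) n ≈⟨ mulLinears-cong≤ (select D X) A≋B n n≤r ⟨
      mulLinears (select D X) (esymOf A) n ≈⟨ mulLinears-comm (select D X) (select A X) one n ⟩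
      mulLinears (select A X) (esymOf D) n ∎
      where open ≈-Reasoning

    X≈A²D : esymOf ⊤ ≋[ r ] mulLinears (select A X) (mulLinears (select A X) (esymOf D))
    X≈A²D n n≤r = begin
      esymOf ⊤ n
        ≡⟨ cong (λ U → esymOf U n) (p∪∁p≡⊤ (A ∪ B)) ⟨
      esymOf ((A ∪ B) ∪ D) n
        ≈⟨ mulLinears-select-∪ (A ∪ B) D X one (Disjoint-∁ (A ∪ B)) n ⟩
      mulLinears (select (A ∪ B) X) (esymOf D) n
        ≈⟨ mulLinears-select-∪ A B X (esymOf D) A∩B=∅ n ⟩
      mulLinears (select A X) (mulLinears (select B X) (esymOf D)) n
        ≈⟨ mulLinears-cong≤ (select A X) B·D≈A·D n n≤r ⟩
      mulLinears (select A X) (mulLinears (select A X) (esymOf D)) n ∎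
      where open ≈-Reasoning

    D-oddFree : OddFree r (esymOf D)
    D-oddFree = mulLinears-square-oddFree (select A X) (esymOf D)
      (OddFree-resp (λ n n≤r → sym (X≈A²D n n≤r)) esymOf-⊤-oddFree)

  -- cancelling P_{A∩B} leaves P_{A∖B} ≡ P_{B∖A} mod t^(r+1), and both have degree ≤ r
  common-neighbour-case : ∀ A B W → ∣ A ∣ ≡ k → ∣ B ∣ ≡ k → ∣ W ∣ ≡ k →
    Disjoint A W → Disjoint B W → A ≢ B → ¬ esymOf A ≋[ r ] esymOf B
  common-neighbour-case A B W ∣A∣≡k ∣B∣≡k ∣W∣≡k A∩W=∅ B∩W=∅ A≢B A≋B =
    disjoint-esymOf-≉ (Disjoint-─-─ A B) (─-nonempty A B ∣A∣≡∣B∣ A≢B)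
      (─-nonempty B A (≡.sym ∣A∣≡∣B∣) (λ B≡A → A≢B (≡.sym B≡A))) A′≋B′
    where
    A′ = A ─ B
    B′ = B ─ A
    C = A ∩ B

    ∣A∣≡∣B∣ : ∣ A ∣ ≡ ∣ B ∣
    ∣A∣≡∣B∣ = ≡.trans ∣A∣≡k (≡.sym ∣B∣≡k)

    ∣B′∣≤r : ∣ B′ ∣ ≤ r
    ∣B′∣≤r = disjoint-∣∣≤r (A ∪ W) B′ (∣∪∣≡k+k ∣A∣≡k ∣W∣≡k A∩W=∅)
      (Disjoint-sym (Disjoint-∪ʳ (Disjoint-─ B A) (Disjoint-⊆ˡ (p─q⊆p B A) B∩W=∅)))

    C·A′≋C·B′ : mulLinears (select C X) (esymOf A′) ≋[ r ] mulLinears (select C X) (esymOf B′)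
    C·A′≋C·B′ n n≤r = begin
      mulLinears (select C X) (esymOf A′) n       ≈⟨ esymOf-split A B n ⟨
      esymOf A n                                  ≈⟨ A≋B n n≤r ⟩
      esymOf B n                                  ≈⟨ esymOf-split B A n ⟩
      mulLinears (select (B ∩ A) X) (esymOf B′) n
        ≡⟨ cong (λ U → mulLinears (select U X) (esymOf B′) n) (∩-comm B A) ⟩
      mulLinears (select C X) (esymOf B′) n       ∎
      where open ≈-Reasoning

    A′≋B′ : esymOf A′ ≋ esymOf B′
    A′≋B′ = ≋[]⇒≋ (mulLinears-cancel≤ (select C X) C·A′≋C·B′)
      (esymOf-vanishes A′ (≡.subst (_≤ r) (≡.sym (∣─∣≡∣─∣ A B ∣A∣≡∣B∣)) ∣B′∣≤r))
      (esymOf-vanishes B′ ∣B′∣≤r)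

  colour : KVertex N k → Fin (q ^ r)
  colour (S , _) = coefficientColour S

  colour-proper : ∀ u v → K²Adj u v → colour u ≢ colour v
  colour-proper (A , ∣A∣≡k) (B , ∣B∣≡k) (_ , inj₁ A∩B=∅) same =
    disjoint-case A B ∣A∣≡k ∣B∣≡k A∩B=∅ (coefficientColour-≡ A B same)
  colour-proper (A , ∣A∣≡k) (B , ∣B∣≡k) (u≢v , inj₂ ((W , ∣W∣≡k) , A∩W=∅ , W∩B=∅)) same =
    common-neighbour-case A B W ∣A∣≡k ∣B∣≡k ∣W∣≡k A∩W=∅ (Disjoint-sym W∩B=∅)
      (λ { ≡.refl → u≢v (cong (A ,_) (≡-irrelevant ∣A∣≡k ∣B∣≡k)) }) (coefficientColour-≡ A B same)

-- The argument never uses r < k.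
theorem3p2 : ∀ {c ℓ : Level} (F : CommutativeRing c ℓ) → IsField F → HasChar2 F →
    (q : ℕ) → HasCardinality F q →
    (k r : ℕ) → 2 ≤ r → r < k →
    (X : Fin (2 * k + r) → CommutativeRing.Carrier F) → DistinctFamily F (2 * k + r) X →
    (∀ (m : ℕ) → 2 * m + 1 ≤ r → CommutativeRing._≈_ F (esym F (2 * k + r) X (2 * m + 1)) (CommutativeRing.0# F)) →
    χK²≤ (2 * k + r) k (q ^ r)
theorem3p2 F isField char2 q card k r 2≤r _ X X-inj X-oddFree = colour , colour-proper
  where open KneserSquareColouring F isField char2 card k r 2≤r X X-inj X-oddFree
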